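{- Let $G=(V,E)$ be a graph and $f:V\to\{0,1,2\}$. Then $f$ is a minimal total Roman dominating function if and only if: (1) $f$ is a total Roman dominating function; (2) for all $v\in V_1(f)$, $N(v)\cap V_2(f)=\emptyset$ or $G[(V_1(f)\cup V_2(f))\setminus\{v\}]$ has an isolated vertex; and (3) for all $v\in V_2(f)$, $P_{G[V_0(f)\cup V_2(f)],V_2(f)}(v)\not\subseteq\{v\}$.
   Context: Graphs are finite, simple and undirected; $N(v)$ is the open neighborhood, $N[v]=N(v)\cup\{v\}$. For a graph $H$, $A\subseteq V(H)$ and $v\in A$, $P_{H,A}(v)=N_H[v]\setminus N_H[A\setminus\{v\}]$. For $f:V\to\{0,1,2\}$, $V_i(f)=\{v: f(v)=i\}$; $f\le g$ is pointwise. A Roman dominating function (Rdf) is an $f:V\to\{0,1,2\}$ such that every $v\in V_0(f)$ has a neighbor in $V_2(f)$. A total Roman dominating function (tRdf) is an Rdf $f$ such that every $v\in V_1(f)\cup V_2(f)$ has a neighbor in $V_1(f)\cup V_2(f)$. It is minimal if no tRdf $g\le f$, $g\ne f$, exists. -}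

module Defs where

open import Data.Nat using (ℕ)
open import Data.Fin using (Fin; zero; suc)
open import Data.Fin.Base using (_≤_)
open import Data.Bool using (Bool; true; false)
open import Data.Product using (Σ; _×_; ∃; ∃-syntax)
open import Data.Sum using (_⊎_)
open import Relation.Binary.PropositionalEquality using (_≡_; _≢_)
open import Relation.Nullary using (¬_)

record Graph (n : ℕ) : Set where
  field
    adj   : Fin n → Fin n → Bool
    sym   : ∀ u v → adj u v ≡ adj v u
    irrfl : ∀ v → adj v v ≡ false

open Graph public

module _ {n : ℕ} (G : Graph n) where

  Adj : Fin n → Fin n → Set
  Adj u v = adj G u v ≡ true

  Sub : Set₁
  Sub = Fin n → Set

  InClosedNbhd : (S : Sub) → Fin n → Fin n → Set
  InClosedNbhd S v u = S v × S u × (u ≡ v ⊎ Adj u v)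

  InClosedNbhdSet : (S : Sub) (A : Sub) → Fin n → Set
  InClosedNbhdSet S A u = ∃[ w ] (A w × InClosedNbhd S w u)

  -- private neighbourhood P_{G[S],A}(v) = N_{G[S]}[v] \ N_{G[S]}[A \ {v}]
  InPrivate : (S : Sub) (A : Sub) (v : Fin n) → Fin n → Set
  InPrivate S A v u =
    InClosedNbhd S v u × ¬ InClosedNbhdSet S (λ w → A w × w ≢ v) u

  IsolatedIn : (S : Sub) → Fin n → Set
  IsolatedIn S w = S w × (∀ u → S u → ¬ Adj w u)

  Fun3 : Set
  Fun3 = Fin n → Fin 3

  V₀ V₁ V₂ : Fun3 → Sub
  V₀ f v = f v ≡ zero
  V₁ f v = f v ≡ suc zero
  V₂ f v = f v ≡ suc (suc zero)

  _≤F_ : Fun3 → Fun3 → Set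
  f ≤F g = ∀ v → f v ≤ g v

  IsRdf : Fun3 → Set
  IsRdf f = ∀ v → V₀ f v → ∃[ u ] (Adj v u × V₂ f u)

  IsTRdf : Fun3 → Set
  IsTRdf f = IsRdf f ×
    (∀ v → ¬ V₀ f v → ∃[ u ] (Adj v u × ¬ V₀ f u))

  IsMinimalTRdf : Fun3 → Set
  IsMinimalTRdf f = IsTRdf f ×
    ¬ (Σ Fun3 λ g → IsTRdf g × g ≤F f × ¬ (∀ v → g v ≡ f v))

-- Lowering a single value is the only move that matters: if a tRdf g < f exists, then at a
-- vertex v where g v ≠ f v either f v = 2 and g v ≤ 1, or f v = 1 and g v = 0. In the first case
-- every vertex of V₀(f) that relied on v for Roman domination must still see another 2, so v has
-- no private neighbour but itself; in the second case v has a 2-neighbour under g, hence under f,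
-- and no vertex of V₁ ∪ V₂ minus v can be isolated, since under g it still has a positive
-- neighbour, which cannot be v. Conversely, when (2) or (3) fails at v, lowering f v by one step
-- (to 0, resp. to 1) is again a tRdf, contradicting minimality.
module Submission where

open import Defs hiding (sym)
open import Data.Nat using (ℕ; z≤n; s≤s)
open import Data.Fin using (Fin; zero; suc; _≤_; _<_; _≟_)
open import Data.Fin.Properties using (any?; all?; ¬∀⟶∃¬; ≤-refl; <⇒≢)
open import Data.Nat.Properties using (<⇒≤)
open import Data.Bool using (true) renaming (_≟_ to _≟ᵇ_)
open import Data.Empty using (⊥; ⊥-elim)
open import Data.Product using (_×_; _,_; proj₁; ∃-syntax)
open import Data.Sum using (_⊎_; inj₁; inj₂; [_,_]′)
open import Data.Vec.Functional using (updateAt)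
open import Data.Vec.Functional.Properties using (updateAt-updates; updateAt-minimal)
open import Function.Base using (const)
open import Function.Bundles using (_⇔_; mk⇔)
open import Relation.Binary.PropositionalEquality using (_≡_; _≢_; refl; sym; trans; subst)
open import Relation.Nullary using (¬_)
open import Relation.Nullary.Decidable using (yes; no; _×-dec_; _→-dec_; ¬?; decidable-stable)
open import Relation.Unary using (Decidable)

one two : Fin 3
one = suc zero
two = suc (suc zero)

nonzero-cases : {a : Fin 3} → a ≢ zero → a ≡ one ⊎ a ≡ two
nonzero-cases {zero}           a≢0 = ⊥-elim (a≢0 refl)
nonzero-cases {suc zero}       _   = inj₁ refl
nonzero-cases {suc (suc zero)} _   = inj₂ refl

one-or-two⇒nonzero : {a : Fin 3} → a ≡ one ⊎ a ≡ two → a ≢ zero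
one-or-two⇒nonzero (inj₁ refl) ()
one-or-two⇒nonzero (inj₂ refl) ()

≤zero⇒zero : {a b : Fin 3} → a ≤ b → b ≡ zero → a ≡ zero
≤zero⇒zero {zero} _ refl = refl

two≤⇒two : {a b : Fin 3} → a ≤ b → a ≡ two → b ≡ two
two≤⇒two {b = suc (suc zero)} _        refl = refl
two≤⇒two {b = zero}           ()       refl
two≤⇒two {b = suc zero}       (s≤s ()) refl

≤one∧≢one⇒zero : {a b : Fin 3} → a ≤ b → b ≡ one → a ≢ one → a ≡ zero
≤one∧≢one⇒zero {zero}           _          refl _   = refl
≤one∧≢one⇒zero {suc zero}       _          refl a≢1 = ⊥-elim (a≢1 refl)
≤one∧≢one⇒zero {suc (suc zero)} (s≤s ())   refl _

module _ {n : ℕ} (G : Graph n) where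

  Adj? : ∀ u → Decidable (Adj G u)
  Adj? u v = adj G u v ≟ᵇ true

  _∖_ : Sub G → Fin n → Sub G
  (S ∖ v) x = S x × x ≢ v

  isolated? : {S : Sub G} → Decidable S → Decidable (IsolatedIn G S)
  isolated? S? w = S? w ×-dec all? (λ u → S? u →-dec ¬? (Adj? w u))

  no-isolated⇒neighbour : {S : Sub G} → Decidable S → ¬ (∃[ w ] IsolatedIn G S w) →
                          ∀ w → S w → ∃[ u ] (S u × Adj G w u)
  no-isolated⇒neighbour S? no-iso w Sw =
    decidable-stable (any? (λ u → S? u ×-dec Adj? w u))
      (λ none → no-iso (w , Sw , λ u Su w~u → none (u , Su , w~u)))

  tRdf⇒positive-neighbour : {g : Fun3 G} → IsTRdf G g → ∀ w → ∃[ x ] (Adj G w x × ¬ V₀ G g x)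
  tRdf⇒positive-neighbour {g} (rdf , total) w with g w ≟ zero
  ... | yes gw≡0 = let x , w~x , gx≡2 = rdf w gw≡0 in x , w~x , one-or-two⇒nonzero (inj₂ gx≡2)
  ... | no  gw≢0 = total w gw≢0

  module _ (f : Fun3 G) where

    V₁₂ V₀₂ : Sub G
    V₁₂ x = V₁ G f x ⊎ V₂ G f x
    V₀₂ x = V₀ G f x ⊎ V₂ G f x

    OnlySelfPrivate : Fin n → Set
    OnlySelfPrivate v = ∀ u → InPrivate G V₀₂ (V₂ G f) v u → u ≡ v

    Condition₂ Condition₃ : Set
    Condition₂ = ∀ v → V₁ G f v →
      (∀ u → Adj G v u → ¬ V₂ G f u) ⊎ (∃[ w ] IsolatedIn G (V₁₂ ∖ v) w)
    Condition₃ = ∀ v → V₂ G f v → ¬ OnlySelfPrivate v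

    V₁₂? : Decidable V₁₂
    V₁₂? x with f x ≟ zero
    ... | yes fx≡0 = no λ fx∈V₁₂ → one-or-two⇒nonzero fx∈V₁₂ fx≡0
    ... | no  fx≢0 = yes (nonzero-cases fx≢0)

  module _ {f g : Fun3 G} (g≤f : _≤F_ G g f) where

    lowered-two⇒only-self-private : IsRdf G g → ∀ {v} → V₂ G f v → ¬ V₂ G g v → OnlySelfPrivate f v
    lowered-two⇒only-self-private rdf {v} _ gv≢2 u ((_ , u∈V₀₂ , _) , not-dominated) with u ≟ v
    ... | yes u≡v = u≡v
    ... | no  u≢v with u∈V₀₂
    ...   | inj₂ fu≡2 = ⊥-elim (not-dominated (u , (fu≡2 , u≢v) , inj₂ fu≡2 , inj₂ fu≡2 , inj₁ refl))
    ...   | inj₁ fu≡0 with rdf u (≤zero⇒zero (g≤f u) fu≡0)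
    ...     | w , u~w , gw≡2 with w ≟ v
    ...       | yes refl = ⊥-elim (gv≢2 gw≡2)
    ...       | no  w≢v  = ⊥-elim (not-dominated
                  (w , (fw≡2 , w≢v) , inj₂ fw≡2 , inj₁ fu≡0 , inj₂ u~w))
      where
      fw≡2 : V₂ G f w
      fw≡2 = two≤⇒two (g≤f w) gw≡2

    lowered-one⇒two-neighbour : IsRdf G g → ∀ {v} → V₀ G g v → ¬ (∀ u → Adj G v u → ¬ V₂ G f u)
    lowered-one⇒two-neighbour rdf {v} gv≡0 no-two-neighbour =
      let u , v~u , gu≡2 = rdf v gv≡0 in no-two-neighbour u v~u (two≤⇒two (g≤f u) gu≡2)

    lowered-one⇒no-isolated : IsTRdf G g → ∀ {v} → V₀ G g v → ¬ (∃[ w ] IsolatedIn G (V₁₂ f ∖ v) w)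
    lowered-one⇒no-isolated g-tRdf {v} gv≡0 (w , _ , isolated)
      with tRdf⇒positive-neighbour g-tRdf w
    ... | x , w~x , gx≢0 = isolated x (nonzero-cases fx≢0 , x≢v) w~x
      where
      fx≢0 : f x ≢ zero
      fx≢0 fx≡0 = gx≢0 (≤zero⇒zero (g≤f x) fx≡0)
      x≢v : x ≢ v
      x≢v refl = gx≢0 gv≡0

  conditions⇒minimal : {f : Fun3 G} → IsTRdf G f → Condition₂ f → Condition₃ f → IsMinimalTRdf G f
  conditions⇒minimal {f} f-tRdf cond₂ cond₃ = f-tRdf , λ (g , g-tRdf , g≤f , g≢f) →
    let v , gv≢fv = ¬∀⟶∃¬ n _ (λ v → g v ≟ f v) g≢f in lowered-at g g-tRdf g≤f v gv≢fv
    where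
    lowered-at : ∀ g → IsTRdf G g → _≤F_ G g f → ∀ v → g v ≢ f v → ⊥
    lowered-at g g-tRdf@(rdf , _) g≤f v gv≢fv with f v in fv
    ... | zero           = gv≢fv (≤zero⇒zero (g≤f v) fv)
    ... | suc zero       = [ lowered-one⇒two-neighbour g≤f rdf gv≡0 , lowered-one⇒no-isolated g≤f g-tRdf gv≡0 ]′
                             (cond₂ v fv)
      where
      gv≡0 : V₀ G g v
      gv≡0 = ≤one∧≢one⇒zero (g≤f v) fv gv≢fv
    ... | suc (suc zero) = cond₃ v fv (lowered-two⇒only-self-private g≤f rdf fv gv≢fv)

  _[_≔_] : Fun3 G → Fin n → Fin 3 → Fun3 G
  f [ v ≔ c ] = updateAt f v (const c)

  ≔-cases : ∀ f v c x → (x ≡ v × (f [ v ≔ c ]) x ≡ c) ⊎ (x ≢ v × (f [ v ≔ c ]) x ≡ f x)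
  ≔-cases f v c x with x ≟ v
  ... | yes refl = inj₁ (refl , updateAt-updates v f)
  ... | no  x≢v  = inj₂ (x≢v , updateAt-minimal x v f x≢v)

  minimal⇒lowering-not-tRdf : ∀ {f} → IsMinimalTRdf G f → ∀ {v a c} → f v ≡ a → c < a →
                              ¬ IsTRdf G (f [ v ≔ c ])
  minimal⇒lowering-not-tRdf {f} (_ , no-smaller) {v} {c = c} refl c<fv g-tRdf =
    no-smaller (f [ v ≔ c ] , g-tRdf , below , differs)
    where
    below : _≤F_ G (f [ v ≔ c ]) f
    below x with ≔-cases f v c x
    ... | inj₁ (refl , gv≡c) = subst (_≤ f v) (sym gv≡c) (<⇒≤ c<fv)
    ... | inj₂ (_ , gx≡fx)    = subst (_≤ f x) (sym gx≡fx) ≤-refl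
    differs : ¬ (∀ x → (f [ v ≔ c ]) x ≡ f x)
    differs same = <⇒≢ c<fv (trans (sym (updateAt-updates v f)) (same v))

  only-self-private⇒other-two-neighbour : ∀ {f v x} → V₂ G f v → OnlySelfPrivate f v →
    V₀ G f x → Adj G x v → ∃[ w ] (Adj G x w × V₂ G f w × w ≢ v)
  only-self-private⇒other-two-neighbour {f} {v} {x} fv≡2 only-self fx≡0 x~v =
    decidable-stable (any? (λ w → Adj? x w ×-dec f w ≟ two ×-dec ¬? (w ≟ v)))
      λ none → x≢v (only-self x ((inj₂ fv≡2 , inj₁ fx≡0 , inj₂ x~v) , not-dominated none))
    where
    x≢v : x ≢ v
    x≢v refl = one-or-two⇒nonzero (inj₂ fv≡2) fx≡0
    not-dominated : ¬ (∃[ w ] (Adj G x w × V₂ G f w × w ≢ v)) →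
                    ¬ InClosedNbhdSet G (V₀₂ f) (V₂ G f ∖ v) x
    not-dominated _    (w , (fw≡2 , _) , _ , _ , inj₁ refl) = one-or-two⇒nonzero (inj₂ fw≡2) fx≡0
    not-dominated none (w , (fw≡2 , w≢v) , _ , _ , inj₂ x~w) = none (w , x~w , fw≡2 , w≢v)

  lowering-two-preserves-tRdf : ∀ {f v} → IsTRdf G f → V₂ G f v → OnlySelfPrivate f v →
                                IsTRdf G (f [ v ≔ one ])
  lowering-two-preserves-tRdf {f} {v} (rdf , total) fv≡2 only-self = rdf′ , total′
    where
    g : Fun3 G
    g = f [ v ≔ one ]
    rdf′ : IsRdf G g
    rdf′ x gx≡0 with ≔-cases f v one x
    ... | inj₁ (refl , gv≡1)  = ⊥-elim (one-or-two⇒nonzero (inj₁ gv≡1) gx≡0)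
    ... | inj₂ (_ , gx≡fx) with rdf x (trans (sym gx≡fx) gx≡0)
    ...   | u , x~u , fu≡2 with ≔-cases f v one u
    ...     | inj₂ (_ , gu≡fu) = u , x~u , trans gu≡fu fu≡2
    ...     | inj₁ (refl , _)  =
                let w , x~w , fw≡2 , w≢v =
                      only-self-private⇒other-two-neighbour fv≡2 only-self (trans (sym gx≡fx) gx≡0) x~u
                in w , x~w , trans (updateAt-minimal w v f w≢v) fw≡2
    positive⇒positive : ∀ x → ¬ V₀ G g x → ¬ V₀ G f x
    positive⇒positive x gx≢0 with ≔-cases f v one x
    ... | inj₁ (refl , _)    = one-or-two⇒nonzero (inj₂ fv≡2)
    ... | inj₂ (_ , gx≡fx)   = λ fx≡0 → gx≢0 (trans gx≡fx fx≡0)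
    positive⇐positive : ∀ x → ¬ V₀ G f x → ¬ V₀ G g x
    positive⇐positive x fx≢0 with ≔-cases f v one x
    ... | inj₁ (refl , gv≡1) = one-or-two⇒nonzero (inj₁ gv≡1)
    ... | inj₂ (_ , gx≡fx)   = λ gx≡0 → fx≢0 (trans (sym gx≡fx) gx≡0)
    total′ : ∀ x → ¬ V₀ G g x → ∃[ u ] (Adj G x u × ¬ V₀ G g u)
    total′ x gx≢0 =
      let u , x~u , fu≢0 = total x (positive⇒positive x gx≢0) in u , x~u , positive⇐positive u fu≢0

  lowering-one-preserves-tRdf : ∀ {f v} → IsTRdf G f → V₁ G f v → ∃[ u ] (Adj G v u × V₂ G f u) →
    (∀ w → (V₁₂ f ∖ v) w → ∃[ u ] ((V₁₂ f ∖ v) u × Adj G w u)) → IsTRdf G (f [ v ≔ zero ])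
  lowering-one-preserves-tRdf {f} {v} (rdf , _) fv≡1 (u₀ , v~u₀ , fu₀≡2) positive-neighbour = rdf′ , total′
    where
    g : Fun3 G
    g = f [ v ≔ zero ]
    two≢v : ∀ {u} → V₂ G f u → u ≢ v
    two≢v fu≡2 refl with trans (sym fu≡2) fv≡1
    ... | ()
    rdf′ : IsRdf G g
    rdf′ x gx≡0 with ≔-cases f v zero x
    ... | inj₁ (refl , _) = u₀ , v~u₀ , trans (updateAt-minimal u₀ v f (two≢v fu₀≡2)) fu₀≡2
    ... | inj₂ (_ , gx≡fx) =
      let u , x~u , fu≡2 = rdf x (trans (sym gx≡fx) gx≡0)
      in u , x~u , trans (updateAt-minimal u v f (two≢v fu≡2)) fu≡2
    total′ : ∀ x → ¬ V₀ G g x → ∃[ u ] (Adj G x u × ¬ V₀ G g u)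
    total′ x gx≢0 with ≔-cases f v zero x
    ... | inj₁ (refl , gv≡0) = ⊥-elim (gx≢0 gv≡0)
    ... | inj₂ (x≢v , gx≡fx) =
      let u , (u∈V₁₂ , u≢v) , x~u = positive-neighbour x (nonzero-cases fx≢0 , x≢v)
      in u , x~u , λ gu≡0 → one-or-two⇒nonzero u∈V₁₂ (trans (sym (updateAt-minimal u v f u≢v)) gu≡0)
      where
      fx≢0 : f x ≢ zero
      fx≢0 fx≡0 = gx≢0 (trans gx≡fx fx≡0)

  minimal⇒condition₂ : ∀ {f} → IsMinimalTRdf G f → Condition₂ f
  minimal⇒condition₂ {f} minimal@(f-tRdf , _) v fv≡1
    with any? (λ u → Adj? v u ×-dec f u ≟ two)
  ... | no  no-two-neighbour = inj₁ λ u v~u fu≡2 → no-two-neighbour (u , v~u , fu≡2)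
  ... | yes two-neighbour    = inj₂ (decidable-stable (any? (isolated? S?)) λ no-isolated →
        minimal⇒lowering-not-tRdf minimal fv≡1 (s≤s z≤n)
          (lowering-one-preserves-tRdf f-tRdf fv≡1 two-neighbour (no-isolated⇒neighbour S? no-isolated)))
    where
    S? : Decidable (V₁₂ f ∖ v)
    S? x = V₁₂? f x ×-dec ¬? (x ≟ v)

  minimal⇒condition₃ : ∀ {f} → IsMinimalTRdf G f → Condition₃ f
  minimal⇒condition₃ minimal@(f-tRdf , _) v fv≡2 only-self =
    minimal⇒lowering-not-tRdf minimal fv≡2 (s≤s (s≤s z≤n))
      (lowering-two-preserves-tRdf f-tRdf fv≡2 only-self)

lemma7 : {n : ℕ} (G : Graph n) (f : Fun3 G) →
    IsMinimalTRdf G f ⇔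
      (IsTRdf G f
       × (∀ v → V₁ G f v →
            (∀ u → Adj G v u → ¬ V₂ G f u)
            ⊎ (∃[ w ] IsolatedIn G (λ x → (V₁ G f x ⊎ V₂ G f x) × x ≢ v) w))
       × (∀ v → V₂ G f v →
            ¬ (∀ u → InPrivate G (λ x → V₀ G f x ⊎ V₂ G f x) (V₂ G f) v u → u ≡ v)))
lemma7 G f = mk⇔
  (λ minimal → proj₁ minimal , minimal⇒condition₂ G minimal , minimal⇒condition₃ G minimal)
  (λ (f-tRdf , cond₂ , cond₃) → conditions⇒minimal G f-tRdf cond₂ cond₃)
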